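{- Let $\mathrm{sort}$ be a sort function satisfying the extended characteristic property. For every type $T$, every total preorder $\leq$ on $T$ and every $s : \mathrm{list}\,T$, we have $\mathrm{sort}_\leq\,s = \mathrm{isort}_\leq\,s$, where the insertion sort is defined by $\mathrm{isort}_\leq\,[] = []$ and $\mathrm{isort}_\leq\,(x :: s) = [x] \mathbin{\land\hspace{ -.45em}\land}_\leq \mathrm{isort}_\leq\,s$.
   Context: A total preorder is a relation that is transitive and total. Lists: $[]$ empty, $x :: s$ cons, $[x]$ singleton, $\mathbin{+\!\!+}$ concatenation, $\mathrm{rev}$ list reversal. A "relation" $\leq$ on a type $T$ is a function $T \to T \to \mathrm{bool}$. Merge: $[] \mathbin{\land\hspace{ -.45em}\land}_\leq ys = ys$, $xs \mathbin{\land\hspace{ -.45em}\land}_\leq [] = xs$, $(x :: xs) \mathbin{\land\hspace{ -.45em}\land}_\leq (y :: ys) = x :: (xs \mathbin{\land\hspace{ -.45em}\land}_\leq (y :: ys))$ if $x \leq y$, else $y :: ((x :: xs) \mathbin{\land\hspace{ -.45em}\land}_\leq ys)$. Define $xs \mathbin{\lor\hspace{ -.45em}\lor}_\leq ys := \mathrm{rev}\,(\mathrm{rev}\,ys \mathbin{\land\hspace{ -.45em}\land}_\geq \mathrm{rev}\,xs)$ where $\geq$ is the converse of $\leq$. A sort function assigns to every type $T$ and relation $\leq$ on $T$ a function $\mathrm{sort}_\leq : \mathrm{list}\,T \to \mathrm{list}\,T$. It satisfies the extended characteristic property if there is a polymorphic $\mathrm{asort}$ of type $\forall (T\,R:\mathcal{U}),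 (T\to T\to\mathrm{bool}) \to (R\to R\to R)\to(R\to R\to R)\to(T\to R)\to R\to\mathrm{list}\,T\to R$ such that (1) $\mathrm{asort}\,(\leq)\,(\mathbin{\land\hspace{ -.45em}\land}_\leq)\,(\mathbin{\lor\hspace{ -.45em}\lor}_\leq)\,(\lambda x.[x])\,[]\,xs = \mathrm{sort}_\leq\,xs$ for all $T,\leq,xs$; (2) $\mathrm{asort}\,(\leq)\,(\mathbin{+\!\!+})\,(\mathbin{+\!\!+})\,(\lambda x.[x])\,[]\,xs = xs$ for all $T,\leq,xs$; (3) $\mathrm{asort}$ is relationally parametric: for all types $T_1,T_2$, relation $\sim_T\subseteq T_1\times T_2$, types $R_1,R_2$, relation $\sim_R\subseteq R_1\times R_2$, all $\leq_i : T_i\to T_i\to\mathrm{bool}$ with $x_1\sim_T x_2\wedge y_1\sim_T y_2 \Rightarrow (x_1\leq_1 y_1)=(x_2\leq_2 y_2)$, all $m_i, m'_i : R_i\to R_i\to R_i$ each pair preserving $\sim_R$ (i.e. $a_1\sim_R a_2\wedge b_1\sim_R b_2\Rightarrow m_1 a_1 b_1 \sim_R m_2 a_2 b_2$, and likewise for $m'$), all $s_i:T_i\to R_i$ with $x_1\sim_T x_2\Rightarrow s_1x_1\sim_R s_2x_2$, all $e_i : R_i$ with $e_1\sim_R e_2$, and all equal-length pointwise $\sim_T$-related lists $xs_1, xs_2$: $\mathrm{asort}\,(\leq_1)\,m_1\,m'_1\,s_1\,e_1\,xs_1 \sim_R \mathrm{asort}\,(\leq_2)\,m_2\,m'_2\,s_2\,e_2\,xs_2$.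 -}

module Defs where

open import Level using (0ℓ)
open import Data.Bool using (Bool; true; false; if_then_else_)
open import Data.List using (List; []; _∷_; [_]; _++_; reverse)
open import Data.List.Relation.Binary.Pointwise using (Pointwise)
open import Data.Sum using (_⊎_)
open import Data.Product using (_×_)
open import Relation.Binary.PropositionalEquality using (_≡_)

Rel : Set → Set
Rel T = T → T → Bool

conv : {T : Set} → Rel T → Rel T
conv r x y = r y x

IsTotalPreorder : {T : Set} → Rel T → Set
IsTotalPreorder {T} r =
  (∀ x y z → r x y ≡ true → r y z ≡ true → r x z ≡ true) ×
  (∀ x y → r x y ≡ true ⊎ r y x ≡ true)

-- merge (written with an inner recursion for structural termination)
merge : {T : Set} → Rel T → List T → List T → List T
merge r [] ys = ys
merge r (x ∷ xs) ys = go ys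
  where
  go : List _ → List _
  go [] = x ∷ xs
  go (y ∷ ys') = if r x y then x ∷ merge r xs (y ∷ ys') else y ∷ go ys'

mergeRev : {T : Set} → Rel T → List T → List T → List T
mergeRev r xs ys = reverse (merge (conv r) (reverse ys) (reverse xs))

isort : {T : Set} → Rel T → List T → List T
isort r [] = []
isort r (x ∷ s) = merge r [ x ] (isort r s)

SortFun : Set₁
SortFun = {T : Set} → Rel T → List T → List T

ASort : Set₁
ASort = (T R : Set) → Rel T → (R → R → R) → (R → R → R) → (T → R) → R → List T → R

Preserves₂ : {R₁ R₂ : Set} → (R₁ → R₂ → Set) → (R₁ → R₁ → R₁) → (R₂ → R₂ → R₂) → Set
Preserves₂ ~R m₁ m₂ = ∀ {a₁ a₂ b₁ b₂} → ~R a₁ a₂ → ~R b₁ b₂ → ~R (m₁ a₁ b₁) (m₂ a₂ b₂)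

Parametric : ASort → Set₁
Parametric asort =
  ∀ (T₁ T₂ : Set) (~T : T₁ → T₂ → Set) (R₁ R₂ : Set) (~R : R₁ → R₂ → Set)
    (le₁ : Rel T₁) (le₂ : Rel T₂) →
    (∀ {x₁ x₂ y₁ y₂} → ~T x₁ x₂ → ~T y₁ y₂ → le₁ x₁ y₁ ≡ le₂ x₂ y₂) →
  ∀ (m₁ m₁' : R₁ → R₁ → R₁) (m₂ m₂' : R₂ → R₂ → R₂) →
    Preserves₂ ~R m₁ m₂ → Preserves₂ ~R m₁' m₂' →
  ∀ (s₁ : T₁ → R₁) (s₂ : T₂ → R₂) → (∀ {x₁ x₂} → ~T x₁ x₂ → ~R (s₁ x₁) (s₂ x₂)) →
  ∀ (e₁ : R₁) (e₂ : R₂) → ~R e₁ e₂ →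
  ∀ (xs₁ : List T₁) (xs₂ : List T₂) → Pointwise ~T xs₁ xs₂ →
    ~R (asort T₁ R₁ le₁ m₁ m₁' s₁ e₁ xs₁) (asort T₂ R₂ le₂ m₂ m₂' s₂ e₂ xs₂)

record ExtCharProp (sort : SortFun) : Set₁ where
  field
    asort : ASort
    asort-sort : ∀ (T : Set) (le : Rel T) (xs : List T) →
      asort T (List T) le (merge le) (mergeRev le) [_] [] xs ≡ sort le xs
    asort-id : ∀ (T : Set) (le : Rel T) (xs : List T) →
      asort T (List T) le _++_ _++_ [_] [] xs ≡ xs
    asort-param : Parametric asort

-- Instantiate the parametricity of asort with the relation  ys ~ xs := ys ≡ isort xs  between
-- lists of T.  Since isort (b ++ c) is obtained from isort b and isort c by merging, and, by
-- stability of insertion sort, also by the reversed merge, both merge operations are related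
-- to concatenation; singletons and [] are related to themselves.  Hence the sort, which is
-- asort run with the merges, is isort of asort run with concatenation, which is the identity.
module Submission where

open import Defs
open import Data.Bool using (true; false)
open import Data.List using (List; []; _∷_; [_]; _++_; reverse)
open import Data.List.Properties using (unfold-reverse; reverse-++; reverse-involutive)
open import Data.List.Relation.Binary.Pointwise using (≡⇒Pointwise-≡)
open import Data.List.Relation.Unary.All as All using (All; []; _∷_)
import Data.List.Relation.Unary.Any.Properties as Any
open import Data.List.Relation.Unary.AllPairs using (AllPairs; []; _∷_)
open import Data.Product using (_,_; proj₁; proj₂)
open import Data.Sum using (inj₁; inj₂)
open import Function using (_∘_)
open import Relation.Binary.PropositionalEquality
  using (_≡_; refl; sym; trans; cong; cong₂; module ≡-Reasoning)

open ≡-Reasoning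

insert : {T : Set} → Rel T → T → List T → List T
insert r x = merge r [ x ]

All-reverse : {T : Set} {P : T → Set} {xs : List T} → All P xs → All P (reverse xs)
All-reverse ps = All.tabulate (All.lookup ps ∘ Any.reverse⁻)

merge-[]ʳ : {T : Set} (r : Rel T) (xs : List T) → merge r xs [] ≡ xs
merge-[]ʳ r []       = refl
merge-[]ʳ r (x ∷ xs) = refl

merge-singletonʳ-All : {T : Set} (r : Rel T) {x : T} {ws : List T} →
  All (λ w → r w x ≡ true) ws → merge r ws [ x ] ≡ ws ++ [ x ]
merge-singletonʳ-All r []                = refl
merge-singletonʳ-All r (w≤x ∷ ws≤x) rewrite w≤x = cong (_ ∷_) (merge-singletonʳ-All r ws≤x)

merge-singletonʳ-∷ʳ : {T : Set} (r : Rel T) {x y : T} → r y x ≡ false →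
  (ws : List T) → merge r (ws ++ [ y ]) [ x ] ≡ merge r ws [ x ] ++ [ y ]
merge-singletonʳ-∷ʳ r y≰x [] rewrite y≰x = refl
merge-singletonʳ-∷ʳ r {x} y≰x (w ∷ ws) with r w x
... | true  = cong (w ∷_) (merge-singletonʳ-∷ʳ r y≰x ws)
... | false = refl

conv-isTotalPreorder : {T : Set} {r : Rel T} → IsTotalPreorder r → IsTotalPreorder (conv r)
conv-isTotalPreorder (≤-trans , ≤-total) =
  (λ x y z y≤x z≤y → ≤-trans z y x z≤y y≤x) , (λ x y → ≤-total y x)

module TotalPreorderProperties {T : Set} {r : Rel T} (tp : IsTotalPreorder r) where

  _≼_ : T → T → Set
  x ≼ y = r x y ≡ true

  Sorted : List T → Set
  Sorted = AllPairs _≼_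

  ≼-trans : ∀ {x y z} → x ≼ y → y ≼ z → x ≼ z
  ≼-trans = proj₁ tp _ _ _

  ≰⇒≽ : ∀ {x y} → r x y ≡ false → y ≼ x
  ≰⇒≽ {x} {y} x≰y with proj₂ tp x y
  ... | inj₂ y≼x = y≼x
  ... | inj₁ x≼y with trans (sym x≼y) x≰y
  ...   | ()

  ≰-≽-trans : ∀ {x y z} → r x y ≡ false → z ≼ y → r x z ≡ false
  ≰-≽-trans {x} {y} {z} x≰y z≼y with r x z in rxz
  ... | false = refl
  ... | true with trans (sym (≼-trans rxz z≼y)) x≰y
  ...   | ()

  merge-insert : ∀ x u v → merge r (insert r x u) v ≡ insert r x (merge r u v)
  merge-insert x []      v       = refl
  merge-insert x (y ∷ u) []      = merge-[]ʳ r (insert r x (y ∷ u))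
  merge-insert x (y ∷ u) (z ∷ v)
    -- the induction hypotheses are bound first so that the case splits below rewrite them too
    with merge-insert x (y ∷ u) v | merge-insert x u (z ∷ v)
  ... | ih₁ | ih₂ with r x y in rxy
  ...   | true with r y z in ryz
  ...     | true rewrite rxy | ≼-trans rxy ryz = refl
  ...     | false with r x z
  ...       | true  = refl
  ...       | false = cong (z ∷_) ih₁
  merge-insert x (y ∷ u) (z ∷ v) | ih₁ | ih₂ | false with r y z in ryz
  ...     | true rewrite rxy = cong (y ∷_) ih₂
  ...     | false rewrite ≰-≽-trans rxy (≰⇒≽ ryz) = cong (z ∷_) ih₁

  merge-isort : ∀ b c → merge r (isort r b) (isort r c) ≡ isort r (b ++ c)
  merge-isort []      c = refl
  merge-isort (x ∷ b) c = begin
    merge r (insert r x (isort r b)) (isort r c) ≡⟨ merge-insert x (isort r b) (isort r c) ⟩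
    insert r x (merge r (isort r b) (isort r c)) ≡⟨ cong (insert r x) (merge-isort b c) ⟩
    insert r x (isort r (b ++ c))                ∎

  insert-All : ∀ {z x u} → z ≼ x → All (z ≼_) u → All (z ≼_) (insert r x u)
  insert-All {u = []}    z≼x []           = z≼x ∷ []
  insert-All {x = x} {u = y ∷ u} z≼x (z≼y ∷ z≼u) with r x y
  ... | true  = z≼x ∷ z≼y ∷ z≼u
  ... | false = z≼y ∷ insert-All z≼x z≼u

  insert-sorted : ∀ x {u} → Sorted u → Sorted (insert r x u)
  insert-sorted x {[]}    []          = [] ∷ []
  insert-sorted x {y ∷ u} (y≼u ∷ u↑) with r x y in rxy
  ... | true  = (rxy ∷ All.map (≼-trans rxy) y≼u) ∷ y≼u ∷ u↑
  ... | false = insert-All (≰⇒≽ rxy) y≼u ∷ insert-sorted x u↑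

  isort-sorted : ∀ l → Sorted (isort r l)
  isort-sorted []      = []
  isort-sorted (x ∷ l) = insert-sorted x (isort-sorted l)

module ConverseProperties {T : Set} {r : Rel T} (tp : IsTotalPreorder r) where

  open TotalPreorderProperties tp
  module ≽ = TotalPreorderProperties (conv-isTotalPreorder tp)

  reverse-insert : ∀ x {u} → Sorted u → reverse (insert r x u) ≡ merge (conv r) (reverse u) [ x ]
  reverse-insert x {[]}    []          = refl
  reverse-insert x {y ∷ u} (y≼u ∷ u↑) with r x y in rxy
  ... | true  = trans (unfold-reverse x (y ∷ u))
      (sym (merge-singletonʳ-All (conv r) (All-reverse (rxy ∷ All.map (≼-trans rxy) y≼u))))
  ... | false = begin
      reverse (y ∷ insert r x u)                    ≡⟨ unfold-reverse y (insert r x u) ⟩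
      reverse (insert r x u) ++ [ y ]               ≡⟨ cong (_++ [ y ]) (reverse-insert x u↑) ⟩
      merge (conv r) (reverse u) [ x ] ++ [ y ]     ≡⟨ merge-singletonʳ-∷ʳ (conv r) rxy (reverse u) ⟨
      merge (conv r) (reverse u ++ [ y ]) [ x ]     ≡⟨ cong (λ t → merge (conv r) t [ x ]) (unfold-reverse y u) ⟨
      merge (conv r) (reverse (y ∷ u)) [ x ]        ∎

  reverse-isort : ∀ l → reverse (isort r l) ≡ isort (conv r) (reverse l)
  reverse-isort []      = refl
  reverse-isort (x ∷ l) = begin
    reverse (insert r x (isort r l))                     ≡⟨ reverse-insert x (isort-sorted l) ⟩
    merge (conv r) (reverse (isort r l)) [ x ]           ≡⟨ cong (λ t → merge (conv r) t [ x ]) (reverse-isort l) ⟩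
    merge (conv r) (isort (conv r) (reverse l)) [ x ]    ≡⟨ ≽.merge-isort (reverse l) [ x ] ⟩
    isort (conv r) (reverse l ++ [ x ])                  ≡⟨ cong (isort (conv r)) (unfold-reverse x l) ⟨
    isort (conv r) (reverse (x ∷ l))                     ∎

  mergeRev-isort : ∀ b c → mergeRev r (isort r b) (isort r c) ≡ isort r (b ++ c)
  mergeRev-isort b c = begin
    reverse (merge (conv r) (reverse (isort r c)) (reverse (isort r b)))
      ≡⟨ cong₂ (λ p q → reverse (merge (conv r) p q)) (reverse-isort c) (reverse-isort b) ⟩
    reverse (merge (conv r) (isort (conv r) (reverse c)) (isort (conv r) (reverse b)))
      ≡⟨ cong reverse (≽.merge-isort (reverse c) (reverse b)) ⟩
    reverse (isort (conv r) (reverse c ++ reverse b))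
      ≡⟨ cong (reverse ∘ isort (conv r)) (reverse-++ b c) ⟨
    reverse (isort (conv r) (reverse (b ++ c)))
      ≡⟨ cong reverse (reverse-isort (b ++ c)) ⟨
    reverse (reverse (isort r (b ++ c)))
      ≡⟨ reverse-involutive (isort r (b ++ c)) ⟩
    isort r (b ++ c) ∎

asort-merge≡isort-asort-++ : {asort : ASort} → Parametric asort →
  {T : Set} {r : Rel T} → IsTotalPreorder r → ∀ xs →
  asort T (List T) r (merge r) (mergeRev r) [_] [] xs ≡ isort r (asort T (List T) r _++_ _++_ [_] [] xs)
asort-merge≡isort-asort-++ asort-param {T} {r} tp xs =
  asort-param T T _≡_ (List T) (List T) _~_ r r (λ { refl refl → refl })
    (merge r) (mergeRev r) _++_ _++_
    -- the implicit lists are bound by hand: isort is not injective, so Agda cannot infer them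
    (λ { {_} {b} {_} {c} refl refl → merge-isort b c })
    (λ { {_} {b} {_} {c} refl refl → mergeRev-isort b c })
    [_] [_] (λ { refl → refl }) [] [] refl xs xs (≡⇒Pointwise-≡ refl)
  where
  open TotalPreorderProperties tp using (merge-isort)
  open ConverseProperties tp using (mergeRev-isort)

  _~_ : List T → List T → Set
  ys ~ xs = ys ≡ isort r xs

lemmaB20 : (sort : SortFun) → ExtCharProp sort →
    ∀ (T : Set) (le : Rel T) → IsTotalPreorder le →
    ∀ (s : List T) → sort le s ≡ isort le s
lemmaB20 sort ecp T le tp s = begin
  sort le s                                                ≡⟨ asort-sort T le s ⟨
  asort T (List T) le (merge le) (mergeRev le) [_] [] s    ≡⟨ asort-merge≡isort-asort-++ asort-param tp s ⟩
  isort le (asort T (List T) le _++_ _++_ [_] [] s)        ≡⟨ cong (isort le) (asort-id T le s) ⟩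
  isort le s                                               ∎
  where open ExtCharProp ecp
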